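{- For $n\ge1$, there is an involution on the set of free Dyck paths of length $2n$ that reverses the parity of the number of flaw blocks; consequently \[\sum_{i=0}^{n}(-1)^i\frac{2i+1}{2n+1}\binom{2n+1}{n-i}=0.\]
   Context: A free Dyck path of length $2n$ is a lattice path from $(0,0)$ to $(2n,0)$ with $n$ up steps $(1,1)$ and $n$ down steps $(1,-1)$. A flaw block is a maximal segment of the path that starts and ends on the $x$-axis and is otherwise strictly below it; the number of flaw blocks equals the number of down steps from height $0$ to height $-1$. -}

module Defs where

open import Data.Nat as ℕ using (ℕ; zero; suc; _∸_; _%_)
open import Data.Nat.Combinatorics using (_C_)
open import Data.Integer as ℤ using (ℤ; +_)
open import Data.Rational as ℚ using (ℚ; 0ℚ; 1ℚ; -_)
open import Data.Vec using (Vec; []; _∷_; toList)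
open import Data.List using (List; []; _∷_)
open import Data.Product using (Σ; proj₁)
open import Relation.Binary.PropositionalEquality using (_≡_)
open import Relation.Nullary using (¬_; yes; no)

-- steps of a lattice path: U = (1,1), D = (1,-1)
data Step : Set where
  U D : Step

countU : List Step → ℕ
countU []      = 0
countU (U ∷ s) = suc (countU s)
countU (D ∷ s) = countU s

FreeDyck : ℕ → Set
FreeDyck n = Σ (Vec Step (2 ℕ.* n)) (λ v → countU (toList v) ≡ n)

flawsFrom : ℤ → List Step → ℕ
flawsFrom h []      = 0
flawsFrom h (U ∷ s) = flawsFrom (h ℤ.+ + 1) s
flawsFrom h (D ∷ s) with h ℤ.≟ + 0
... | yes _ = suc (flawsFrom (h ℤ.- + 1) s)
... | no  _ = flawsFrom (h ℤ.- + 1) s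

flawBlocks : {n : ℕ} → FreeDyck n → ℕ
flawBlocks p = flawsFrom (+ 0) (toList (proj₁ p))

signℚ : ℕ → ℚ
signℚ zero    = 1ℚ
signℚ (suc i) = - signℚ i

sumTo : ℕ → (ℕ → ℚ) → ℚ
sumTo zero    f = f 0
sumTo (suc n) f = sumTo n f ℚ.+ f (suc n)

term : ℕ → ℕ → ℚ
term n i = signℚ i ℚ.* ((+ (2 ℕ.* i ℕ.+ 1) ℚ./ suc (2 ℕ.* n)) ℚ.* (+ (suc (2 ℕ.* n) C (n ∸ i)) ℚ./ 1))

-- Reflecting the first block of a free Dyck path (the segment up to its first
-- return to the axis) in the axis is an involution preserving the number of up
-- steps; it turns an excursion above the axis into a flaw block or vice versa,
-- so the number of flaw blocks changes by exactly one.
--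
-- For the identity, absorption and Pascal's rule show that
-- (2i+1)/(2n+1) C(2n+1, n-i) is the ballot number C(2n, n+i) - C(2n, n+i+1).
-- By Pascal again this is e i - e (i+2) with e j = C(2n-1, n-1+j), so the
-- alternating sum telescopes to e 0 - e 1 ± (e (n+1) - e (n+2)), which vanishes
-- by the symmetry of binomial coefficients and since e j = 0 for j > n.

module Submission where

open import Defs
open import Data.Nat as ℕ using (ℕ; zero; suc; _≥_; _%_; _≤_; _<_; z≤n; s≤s)
import Data.Nat.Properties as ℕP
open import Data.Nat.Combinatorics using (_C_; nCk+nC[k+1]≡[n+1]C[k+1]; nCk≡nC[n∸k]; nC1≡n)
open import Data.Nat.Combinatorics.Specification using (k>n⇒nCk≡0)
import Data.Nat.Tactic.RingSolver as ℕSolver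
open import Data.Integer using (ℤ; +_; -[1+_]; _+_; _-_; _*_; -_; _≟_)
import Data.Integer.Properties as ℤP
open import Data.Integer.Tactic.RingSolver using (solve-∀)
open import Data.Rational as ℚ using (ℚ; 0ℚ; toℚᵘ)
open import Data.Rational.Properties
  using (toℚᵘ-injective; toℚᵘ-fromℚᵘ; toℚᵘ-homo-+; toℚᵘ-homo-*; toℚᵘ-homo‿-)
open import Data.Rational.Unnormalised using (mkℚᵘ; *≡*) renaming (_≃_ to _≃ᵘ_)
import Data.Rational.Unnormalised.Properties as ℚᵘP
open import Data.List using (List; []; _∷_; length)
open import Data.Vec using (Vec; []; _∷_; toList)
open import Data.Vec.Properties using (length-toList)
open import Data.Product using (Σ; _×_; _,_; proj₁)
open import Data.Sum using (_⊎_; inj₁; inj₂)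
open import Function using (_∘_)
open import Relation.Binary.PropositionalEquality
open import Relation.Nullary using (yes; no; contradiction)
open ≡-Reasoning

flipStep : Step → Step
flipStep U = D
flipStep D = U

flipStep-involutive : ∀ x → flipStep (flipStep x) ≡ x
flipStep-involutive U = refl
flipStep-involutive D = refl

move : ℤ → Step → ℤ
move h U = h + + 1
move h D = h - + 1

move-flipStep : ∀ h x → move (- h) (flipStep x) ≡ - move h x
move-flipStep h U = lemma h
  where lemma : ∀ h → - h - + 1 ≡ - (h + + 1)
        lemma = solve-∀
move-flipStep h D = lemma h
  where lemma : ∀ h → - h + + 1 ≡ - (h - + 1)
        lemma = solve-∀

-- reflectToAxis h v flips the steps of v, read as a path from height h, up to
-- and including its first step onto the axis; the first step is flipped even
-- when h = 0, so reflectToAxis (+ 0) reflects the first block.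
mutual
  reflectToAxis : ∀ {k} → ℤ → Vec Step k → Vec Step k
  reflectToAxis h []      = []
  reflectToAxis h (x ∷ s) = flipStep x ∷ reflectOffAxis (move h x) s

  reflectOffAxis : ∀ {k} → ℤ → Vec Step k → Vec Step k
  reflectOffAxis (+ zero)      s = s
  reflectOffAxis h@(+ suc _)   s = reflectToAxis h s
  reflectOffAxis h@(-[1+ _ ])  s = reflectToAxis h s

mutual
  reflectToAxis-involutive : ∀ {k} h (v : Vec Step k) → reflectToAxis (- h) (reflectToAxis h v) ≡ v
  reflectToAxis-involutive h []      = refl
  reflectToAxis-involutive h (x ∷ s)
    rewrite move-flipStep h x | flipStep-involutive x = cong (x ∷_) (reflectOffAxis-involutive (move h x) s)

  reflectOffAxis-involutive : ∀ {k} h (v : Vec Step k) → reflectOffAxis (- h) (reflectOffAxis h v) ≡ v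
  reflectOffAxis-involutive (+ zero)     s = refl
  reflectOffAxis-involutive h@(+ suc _)  s = reflectToAxis-involutive h s
  reflectOffAxis-involutive h@(-[1+ _ ]) s = reflectToAxis-involutive h s

flawsFrom-offAxis : ∀ h x s → h ≢ + 0 → flawsFrom h (x ∷ s) ≡ flawsFrom (move h x) s
flawsFrom-offAxis h U s _ = refl
flawsFrom-offAxis h D s h≢0 with h ≟ + 0
... | yes h≡0 = contradiction h≡0 h≢0
... | no _    = refl

mutual
  flawsFrom-reflectToAxis : ∀ {k} h (v : Vec Step k) → h ≢ + 0 →
    flawsFrom (- h) (toList (reflectToAxis h v)) ≡ flawsFrom h (toList v)
  flawsFrom-reflectToAxis h []      _   = refl
  flawsFrom-reflectToAxis h (x ∷ s) h≢0 = begin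
    flawsFrom (- h) (flipStep x ∷ rest)
      ≡⟨ flawsFrom-offAxis (- h) (flipStep x) rest (h≢0 ∘ ℤP.neg-injective) ⟩
    flawsFrom (move (- h) (flipStep x)) rest
      ≡⟨ cong (λ h′ → flawsFrom h′ rest) (move-flipStep h x) ⟩
    flawsFrom (- move h x) rest
      ≡⟨ flawsFrom-reflectOffAxis (move h x) s ⟩
    flawsFrom (move h x) (toList s)
      ≡⟨ flawsFrom-offAxis h x (toList s) h≢0 ⟨
    flawsFrom h (x ∷ toList s)
      ∎
    where
    rest = toList (reflectOffAxis (move h x) s)

  flawsFrom-reflectOffAxis : ∀ {k} h (v : Vec Step k) →
    flawsFrom (- h) (toList (reflectOffAxis h v)) ≡ flawsFrom h (toList v)
  flawsFrom-reflectOffAxis (+ zero)     s = refl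
  flawsFrom-reflectOffAxis h@(+ suc _)  s = flawsFrom-reflectToAxis h s λ ()
  flawsFrom-reflectOffAxis h@(-[1+ _ ]) s = flawsFrom-reflectToAxis h s λ ()

endHeight : ℤ → List Step → ℤ
endHeight h []      = h
endHeight h (x ∷ s) = endHeight (move h x) s

mutual
  countU-reflectToAxis : ∀ {k} h (v : Vec Step k) → endHeight h (toList v) ≡ + 0 →
    + countU (toList (reflectToAxis h v)) ≡ + countU (toList v) + h
  countU-reflectToAxis h [] returns = sym (trans (ℤP.+-identityˡ h) returns)
  countU-reflectToAxis h (U ∷ s) returns = begin
    + countU (toList (reflectOffAxis (h + + 1) s)) ≡⟨ countU-reflectOffAxis (h + + 1) s returns ⟩
    + countU (toList s) + (h + + 1)                ≡⟨ lemma (+ countU (toList s)) h ⟩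
    + suc (countU (toList s)) + h                  ∎
    where
    lemma : ∀ c h → c + (h + + 1) ≡ + 1 + c + h
    lemma = solve-∀
  countU-reflectToAxis h (D ∷ s) returns = begin
    + suc (countU (toList (reflectOffAxis (h - + 1) s)))
      ≡⟨ cong (_+_ (+ 1)) (countU-reflectOffAxis (h - + 1) s returns) ⟩
    + 1 + (+ countU (toList s) + (h - + 1))             ≡⟨ lemma (+ countU (toList s)) h ⟩
    + countU (toList s) + h                             ∎
    where
    lemma : ∀ c h → + 1 + (c + (h - + 1)) ≡ c + h
    lemma = solve-∀

  countU-reflectOffAxis : ∀ {k} h (v : Vec Step k) → endHeight h (toList v) ≡ + 0 →
    + countU (toList (reflectOffAxis h v)) ≡ + countU (toList v) + h
  countU-reflectOffAxis (+ zero)     s _       = sym (ℤP.+-identityʳ _)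
  countU-reflectOffAxis h@(+ suc _)  s returns = countU-reflectToAxis h s returns
  countU-reflectOffAxis h@(-[1+ _ ]) s returns = countU-reflectToAxis h s returns

endHeight-countU : ∀ h l → endHeight h l ≡ h + (+ countU l + + countU l) - + length l
endHeight-countU h []      = lemma h
  where lemma : ∀ h → h ≡ h + (+ 0 + + 0) - + 0
        lemma = solve-∀
endHeight-countU h (U ∷ s) = trans (endHeight-countU (h + + 1) s) (lemma h (+ countU s) (+ length s))
  where lemma : ∀ h c l → h + + 1 + (c + c) - l ≡ h + (+ 1 + c + (+ 1 + c)) - (+ 1 + l)
        lemma = solve-∀
endHeight-countU h (D ∷ s) = trans (endHeight-countU (h - + 1) s) (lemma h (+ countU s) (+ length s))
  where lemma : ∀ h c l → h - + 1 + (c + c) - l ≡ h + (c + c) - (+ 1 + l)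
        lemma = solve-∀

freeDyck-returns : ∀ {n} (p : FreeDyck n) → endHeight (+ 0) (toList (proj₁ p)) ≡ + 0
freeDyck-returns {n} (v , countU≡n) = begin
  endHeight (+ 0) (toList v)
    ≡⟨ endHeight-countU (+ 0) (toList v) ⟩
  + 0 + (+ countU (toList v) + + countU (toList v)) - + length (toList v)
    ≡⟨ cong₂ (λ c l → + 0 + (+ c + + c) - + l) countU≡n (length-toList v) ⟩
  + 0 + (+ n + + n) - + (n ℕ.+ (n ℕ.+ 0))
    ≡⟨ cong (λ m → + 0 + (+ n + + n) - + (n ℕ.+ m)) (ℕP.+-identityʳ n) ⟩
  + 0 + (+ n + + n) - (+ n + + n)
    ≡⟨ lemma (+ n + + n) ⟩
  + 0
    ∎
  where
  lemma : ∀ m → + 0 + m - m ≡ + 0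
  lemma = solve-∀

mirror : ∀ {n} → FreeDyck n → FreeDyck n
mirror {n} p@(v , countU≡n) = reflectToAxis (+ 0) v , ℤP.+-injective (begin
  + countU (toList (reflectToAxis (+ 0) v)) ≡⟨ countU-reflectToAxis (+ 0) v (freeDyck-returns p) ⟩
  + countU (toList v) + + 0                  ≡⟨ ℤP.+-identityʳ _ ⟩
  + countU (toList v)                        ≡⟨ cong +_ countU≡n ⟩
  + n                                        ∎)

mirror-involutive : ∀ {n} (p : FreeDyck n) → proj₁ (mirror (mirror p)) ≡ proj₁ p
mirror-involutive (v , _) = reflectToAxis-involutive (+ 0) v

flawBlocks-mirror : ∀ {m} (p : FreeDyck (suc m)) →
  flawBlocks (mirror p) ≡ suc (flawBlocks p) ⊎ flawBlocks p ≡ suc (flawBlocks (mirror p))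
flawBlocks-mirror (U ∷ s , _) = inj₁ (cong suc (flawsFrom-reflectOffAxis (+ 1) s))
flawBlocks-mirror (D ∷ s , _) = inj₂ (cong suc (sym (flawsFrom-reflectOffAxis -[1+ 0 ] s)))

[1+n]%2≢n%2 : ∀ n → suc n % 2 ≢ n % 2
[1+n]%2≢n%2 zero          ()
[1+n]%2≢n%2 (suc zero)    ()
[1+n]%2≢n%2 (suc (suc n)) eq = [1+n]%2≢n%2 n eq

flawBlocks-mirror-parity : ∀ {m} (p : FreeDyck (suc m)) → flawBlocks (mirror p) % 2 ≢ flawBlocks p % 2
flawBlocks-mirror-parity p with flawBlocks-mirror p
... | inj₁ eq rewrite eq = [1+n]%2≢n%2 (flawBlocks p)
... | inj₂ eq rewrite eq = [1+n]%2≢n%2 (flawBlocks (mirror p)) ∘ sym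

[k+1]*[n+1]C[k+1]≡[n+1]*nCk : ∀ n k → suc k ℕ.* (suc n C suc k) ≡ suc n ℕ.* (n C k)
[k+1]*[n+1]C[k+1]≡[n+1]*nCk zero    zero    = refl
[k+1]*[n+1]C[k+1]≡[n+1]*nCk zero    (suc k) =
  trans (cong (suc (suc k) ℕ.*_) (k>n⇒nCk≡0 {1} {suc (suc k)} (s≤s (s≤s z≤n))))
        (ℕP.*-zeroʳ (suc (suc k)))
[k+1]*[n+1]C[k+1]≡[n+1]*nCk (suc n) zero    =
  trans (ℕP.+-identityʳ _) (trans (nC1≡n (suc (suc n))) (sym (ℕP.*-identityʳ _)))
[k+1]*[n+1]C[k+1]≡[n+1]*nCk (suc n) (suc k) = begin
  suc (suc k) ℕ.* (suc N C suc (suc k))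
    ≡⟨ cong (suc (suc k) ℕ.*_) (nCk+nC[k+1]≡[n+1]C[k+1] N (suc k)) ⟨
  suc (suc k) ℕ.* (X ℕ.+ Y)
    ≡⟨ distribute k X Y ⟩
  X ℕ.+ (suc k ℕ.* X ℕ.+ suc (suc k) ℕ.* Y)
    ≡⟨ cong₂ (λ u v → X ℕ.+ (u ℕ.+ v))
             ([k+1]*[n+1]C[k+1]≡[n+1]*nCk n k) ([k+1]*[n+1]C[k+1]≡[n+1]*nCk n (suc k)) ⟩
  X ℕ.+ (N ℕ.* (n C k) ℕ.+ N ℕ.* (n C suc k))
    ≡⟨ cong (X ℕ.+_) (ℕP.*-distribˡ-+ N (n C k) (n C suc k)) ⟨
  X ℕ.+ N ℕ.* ((n C k) ℕ.+ (n C suc k))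
    ≡⟨ cong (λ u → X ℕ.+ N ℕ.* u) (nCk+nC[k+1]≡[n+1]C[k+1] n k) ⟩
  X ℕ.+ N ℕ.* X
    ∎
  where
  N = suc n
  X = N C suc k
  Y = N C suc (suc k)
  distribute : ∀ k X Y → (2 ℕ.+ k) ℕ.* (X ℕ.+ Y) ≡ X ℕ.+ ((1 ℕ.+ k) ℕ.* X ℕ.+ (2 ℕ.+ k) ℕ.* Y)
  distribute = ℕSolver.solve-∀

[m+n]Cm≡[m+n]Cn : ∀ m n → (m ℕ.+ n) C m ≡ (m ℕ.+ n) C n
[m+n]Cm≡[m+n]Cn m n = trans (nCk≡nC[n∸k] (ℕP.m≤m+n m n)) (cong ((m ℕ.+ n) C_) (ℕP.m+n∸m≡n m n))

ballot-absorption : ∀ m k (a : ℤ) → a + + suc m ≡ + suc k + + suc k →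
  a * + (suc m C suc k) ≡ + suc m * (+ (m C k) - + (m C suc k))
ballot-absorption m k a a+M≡K+K = begin
  a * X                     ≡⟨ expand a M X ⟩
  (a + M) * X - M * X       ≡⟨ cong (λ b → b * X - M * X) a+M≡K+K ⟩
  (K + K) * X - M * X       ≡⟨ distrib K X (M * X) ⟩
  K * X + K * X - M * X     ≡⟨ cong₂ (λ u v → u + u - M * v) absorb pascal ⟨
  M * Y + M * Y - M * (Y + Z) ≡⟨ collect M Y Z ⟩
  M * (Y - Z)               ∎
  where
  M = + suc m
  K = + suc k
  X = + (suc m C suc k)
  Y = + (m C k)
  Z = + (m C suc k)
  absorb : M * Y ≡ K * X
  absorb = trans (sym (ℤP.pos-* (suc m) (m C k)))
    (trans (cong +_ (sym ([k+1]*[n+1]C[k+1]≡[n+1]*nCk m k))) (ℤP.pos-* (suc k) (suc m C suc k)))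
  pascal : Y + Z ≡ X
  pascal = cong +_ (nCk+nC[k+1]≡[n+1]C[k+1] m k)
  expand : ∀ a M X → a * X ≡ (a + M) * X - M * X
  expand = solve-∀
  distrib : ∀ K X W → (K + K) * X - W ≡ K * X + K * X - W
  distrib = solve-∀
  collect : ∀ M Y Z → M * Y + M * Y - M * (Y + Z) ≡ M * (Y - Z)
  collect = solve-∀

ballot : ℕ → ℕ → ℤ
ballot n i = + (2 ℕ.* n C (n ℕ.+ i)) - + (2 ℕ.* n C suc (n ℕ.+ i))

ballot-identity : ∀ {n i} → i ≤ n →
  + (2 ℕ.* i ℕ.+ 1) * + (suc (2 ℕ.* n) C (n ℕ.∸ i)) ≡ + suc (2 ℕ.* n) * ballot n i
ballot-identity {n} {i} i≤n with ℕP.m≤n⇒∃[o]m+o≡n i≤n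
... | j , refl = begin
  + (2 ℕ.* i ℕ.+ 1) * + (S C ((i ℕ.+ j) ℕ.∸ i))
    ≡⟨ cong (λ c → + (2 ℕ.* i ℕ.+ 1) * + c) symmetric ⟩
  + (2 ℕ.* i ℕ.+ 1) * + (S C K)
    ≡⟨ ballot-absorption (2 ℕ.* (i ℕ.+ j)) (i ℕ.+ j ℕ.+ i) (+ (2 ℕ.* i ℕ.+ 1))
                         (cong +_ (weights i j)) ⟩
  + S * ballot (i ℕ.+ j) i
    ∎
  where
  S = suc (2 ℕ.* (i ℕ.+ j))
  K = suc (i ℕ.+ j ℕ.+ i)
  split : ∀ i j → suc (2 ℕ.* (i ℕ.+ j)) ≡ j ℕ.+ suc (i ℕ.+ j ℕ.+ i)
  split = ℕSolver.solve-∀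
  weights : ∀ i j →
    2 ℕ.* i ℕ.+ 1 ℕ.+ suc (2 ℕ.* (i ℕ.+ j)) ≡ suc (i ℕ.+ j ℕ.+ i) ℕ.+ suc (i ℕ.+ j ℕ.+ i)
  weights = ℕSolver.solve-∀
  symmetric : S C ((i ℕ.+ j) ℕ.∸ i) ≡ S C K
  symmetric = begin
    S C ((i ℕ.+ j) ℕ.∸ i) ≡⟨ cong (S C_) (ℕP.m+n∸m≡n i j) ⟩
    S C j                 ≡⟨ cong (_C j) (split i j) ⟩
    (j ℕ.+ K) C j         ≡⟨ [m+n]Cm≡[m+n]Cn j K ⟩
    (j ℕ.+ K) C K         ≡⟨ cong (_C K) (split i j) ⟨
    S C K                 ∎

ballot-pascal : ∀ m k → + (suc m C suc k) - + (suc m C suc (suc k)) ≡ + (m C k) - + (m C suc (suc k))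
ballot-pascal m k = begin
  + (suc m C suc k) - + (suc m C suc (suc k))
    ≡⟨ cong₂ (λ x y → + x - + y) (nCk+nC[k+1]≡[n+1]C[k+1] m k) (nCk+nC[k+1]≡[n+1]C[k+1] m (suc k)) ⟨
  + (m C k) + + (m C suc k) - (+ (m C suc k) + + (m C suc (suc k)))
    ≡⟨ cancel (+ (m C k)) (+ (m C suc k)) (+ (m C suc (suc k))) ⟩
  + (m C k) - + (m C suc (suc k)) ∎
  where cancel : ∀ x y z → x + y - (y + z) ≡ x - z
        cancel = solve-∀

signℤ : ℕ → ℤ
signℤ zero    = + 1
signℤ (suc i) = - signℤ i

sumToℤ : ℕ → (ℕ → ℤ) → ℤ
sumToℤ zero    f = f 0
sumToℤ (suc n) f = sumToℤ n f + f (suc n)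

sumToℤ-cong : ∀ n {f g : ℕ → ℤ} → (∀ i → f i ≡ g i) → sumToℤ n f ≡ sumToℤ n g
sumToℤ-cong zero    f≗g = f≗g 0
sumToℤ-cong (suc n) f≗g = cong₂ _+_ (sumToℤ-cong n f≗g) (f≗g (suc n))

alternating-telescope : ∀ (e : ℕ → ℤ) j →
  sumToℤ j (λ i → signℤ i * (e i - e (2 ℕ.+ i))) ≡ e 0 - e 1 + signℤ j * (e (1 ℕ.+ j) - e (2 ℕ.+ j))
alternating-telescope e zero    = lemma (e 0) (e 1) (e 2)
  where lemma : ∀ a b c → + 1 * (a - c) ≡ a - b + + 1 * (b - c)
        lemma = solve-∀
alternating-telescope e (suc j) =
  trans (cong (_+ signℤ (suc j) * (e (suc j) - e (3 ℕ.+ j))) (alternating-telescope e j))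
        (lemma (e 0 - e 1) (signℤ j) (e (1 ℕ.+ j)) (e (2 ℕ.+ j)) (e (3 ℕ.+ j)))
  where lemma : ∀ t s x y z → t + s * (x - y) + (- s) * (x - z) ≡ t + (- s) * (y - z)
        lemma = solve-∀

alternating-ballot-sum : ∀ p → sumToℤ (suc p) (λ i → signℤ i * ballot (suc p) i) ≡ + 0
alternating-ballot-sum p = begin
  sumToℤ (suc p) (λ i → signℤ i * ballot (suc p) i)
    ≡⟨ sumToℤ-cong (suc p) (λ i → cong (signℤ i *_) (ballot≡ i)) ⟩
  sumToℤ (suc p) (λ i → signℤ i * (e i - e (2 ℕ.+ i)))
    ≡⟨ alternating-telescope e (suc p) ⟩
  e 0 - e 1 + signℤ (suc p) * (e (2 ℕ.+ p) - e (3 ℕ.+ p))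
    ≡⟨ cong₂ (λ x y → e 0 - x + signℤ (suc p) * y)
             (sym central) (cong₂ _-_ (vanish beyond₁) (vanish beyond₂)) ⟩
  e 0 - e 0 + signℤ (suc p) * (+ 0 - + 0)
    ≡⟨ cancel (e 0) (signℤ (suc p)) ⟩
  + 0
    ∎
  where
  -- N = 2p + 1, written as the normal form of ℕ.pred (2 ℕ.* suc p)
  N = p ℕ.+ suc (p ℕ.+ 0)
  e : ℕ → ℤ
  e j = + (N C (p ℕ.+ j))
  ballot≡ : ∀ i → ballot (suc p) i ≡ e i - e (2 ℕ.+ i)
  ballot≡ i = trans (ballot-pascal N (p ℕ.+ i))
    (cong (λ k → e i - + (N C k)) (sym (trans (ℕP.+-suc p (suc i)) (cong suc (ℕP.+-suc p i)))))
  central : e 0 ≡ e 1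
  central = cong +_ (begin
    N C (p ℕ.+ 0)     ≡⟨ cong (N C_) (ℕP.+-identityʳ p) ⟩
    N C p             ≡⟨ [m+n]Cm≡[m+n]Cn p (suc (p ℕ.+ 0)) ⟩
    N C suc (p ℕ.+ 0) ≡⟨ cong (N C_) (ℕP.+-suc p 0) ⟨
    N C (p ℕ.+ 1)     ∎)
  vanish : ∀ {k} → N < k → + (N C k) ≡ + 0
  vanish N<k = cong +_ (k>n⇒nCk≡0 N<k)
  beyond₁ : N < p ℕ.+ suc (suc p)
  beyond₁ = ℕP.+-monoʳ-< p (s≤s (s≤s (ℕP.≤-reflexive (ℕP.+-identityʳ p))))
  beyond₂ : N < p ℕ.+ suc (suc (suc p))
  beyond₂ = ℕP.+-monoʳ-< p (s≤s (s≤s (ℕP.m≤n⇒m≤1+n (ℕP.≤-reflexive (ℕP.+-identityʳ p)))))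
  cancel : ∀ x s → x - x + s * (+ 0 - + 0) ≡ + 0
  cancel = solve-∀

fromℤ : ℤ → ℚ
fromℤ z = z ℚ./ 1

toℚᵘ-fromℤ : ∀ z → toℚᵘ (fromℤ z) ≃ᵘ mkℚᵘ z 0
toℚᵘ-fromℤ z = toℚᵘ-fromℚᵘ (mkℚᵘ z 0)

fromℤ-unique : ∀ z q → toℚᵘ q ≃ᵘ mkℚᵘ z 0 → fromℤ z ≡ q
fromℤ-unique z q q≃z = toℚᵘ-injective (ℚᵘP.≃-trans (toℚᵘ-fromℤ z) (ℚᵘP.≃-sym q≃z))

fromℤ-+ : ∀ a b → fromℤ (a + b) ≡ fromℤ a ℚ.+ fromℤ b
fromℤ-+ a b = fromℤ-unique (a + b) _ (ℚᵘP.≃-trans (toℚᵘ-homo-+ (fromℤ a) (fromℤ b))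
  (ℚᵘP.≃-trans (ℚᵘP.+-cong (toℚᵘ-fromℤ a) (toℚᵘ-fromℤ b)) (*≡* (lemma a b))))
  where lemma : ∀ a b → (a * + 1 + b * + 1) * + 1 ≡ (a + b) * + 1
        lemma = solve-∀

fromℤ-* : ∀ a b → fromℤ (a * b) ≡ fromℤ a ℚ.* fromℤ b
fromℤ-* a b = fromℤ-unique (a * b) _ (ℚᵘP.≃-trans (toℚᵘ-homo-* (fromℤ a) (fromℤ b))
  (ℚᵘP.≃-trans (ℚᵘP.*-cong (toℚᵘ-fromℤ a) (toℚᵘ-fromℤ b)) (*≡* refl)))

fromℤ-neg : ∀ a → fromℤ (- a) ≡ ℚ.- fromℤ a
fromℤ-neg a = fromℤ-unique (- a) _ (ℚᵘP.≃-trans (toℚᵘ-homo‿- (fromℤ a))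
  (ℚᵘP.≃-trans (ℚᵘP.-‿cong (toℚᵘ-fromℤ a)) (*≡* refl)))

/-*-fromℤ : ∀ a c {b} d → a * c ≡ + suc d * b → (a ℚ./ suc d) ℚ.* fromℤ c ≡ fromℤ b
/-*-fromℤ a c {b} d ac≡[1+d]b = sym (fromℤ-unique b _
  (ℚᵘP.≃-trans (toℚᵘ-homo-* (a ℚ./ suc d) (fromℤ c))
  (ℚᵘP.≃-trans (ℚᵘP.*-cong (toℚᵘ-fromℚᵘ (mkℚᵘ a d)) (toℚᵘ-fromℤ c)) (*≡* cross))))
  where
  cross : a * c * + 1 ≡ b * + (suc d ℕ.* 1)
  cross = begin
    a * c * + 1          ≡⟨ ℤP.*-identityʳ (a * c) ⟩
    a * c                ≡⟨ ac≡[1+d]b ⟩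
    + suc d * b          ≡⟨ ℤP.*-comm (+ suc d) b ⟩
    b * + suc d          ≡⟨ cong (λ k → b * + k) (ℕP.*-identityʳ (suc d)) ⟨
    b * + (suc d ℕ.* 1)  ∎

signℚ-fromℤ : ∀ i → signℚ i ≡ fromℤ (signℤ i)
signℚ-fromℤ zero    = refl
signℚ-fromℤ (suc i) = trans (cong ℚ.-_ (signℚ-fromℤ i)) (sym (fromℤ-neg (signℤ i)))

sumTo-fromℤ : ∀ n f → sumTo n (λ i → fromℤ (f i)) ≡ fromℤ (sumToℤ n f)
sumTo-fromℤ zero    f = refl
sumTo-fromℤ (suc n) f =
  trans (cong (ℚ._+ fromℤ (f (suc n))) (sumTo-fromℤ n f)) (sym (fromℤ-+ (sumToℤ n f) (f (suc n))))

sumTo-cong : ∀ n {f g : ℕ → ℚ} → (∀ {i} → i ≤ n → f i ≡ g i) → sumTo n f ≡ sumTo n g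
sumTo-cong zero    f≗g = f≗g z≤n
sumTo-cong (suc n) f≗g = cong₂ ℚ._+_ (sumTo-cong n (f≗g ∘ ℕP.m≤n⇒m≤1+n)) (f≗g ℕP.≤-refl)

term≡fromℤ-ballot : ∀ {n i} → i ≤ n → term n i ≡ fromℤ (signℤ i * ballot n i)
term≡fromℤ-ballot {n} {i} i≤n = begin
  term n i
    ≡⟨ cong₂ ℚ._*_ (signℚ-fromℤ i) (/-*-fromℤ weight binomial (2 ℕ.* n) (ballot-identity i≤n)) ⟩
  fromℤ (signℤ i) ℚ.* fromℤ (ballot n i)
    ≡⟨ fromℤ-* (signℤ i) (ballot n i) ⟨
  fromℤ (signℤ i * ballot n i)
    ∎
  where
  weight = + (2 ℕ.* i ℕ.+ 1)
  binomial = + (suc (2 ℕ.* n) C (n ℕ.∸ i))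

alternating-sum≡0 : ∀ p → sumTo (suc p) (term (suc p)) ≡ 0ℚ
alternating-sum≡0 p = begin
  sumTo (suc p) (term (suc p))                              ≡⟨ sumTo-cong (suc p) term≡fromℤ-ballot ⟩
  sumTo (suc p) (λ i → fromℤ (signℤ i * ballot (suc p) i))  ≡⟨ sumTo-fromℤ (suc p) _ ⟩
  fromℤ (sumToℤ (suc p) (λ i → signℤ i * ballot (suc p) i)) ≡⟨ cong fromℤ (alternating-ballot-sum p) ⟩
  0ℚ                                                        ∎

theorem4p1 : (n : ℕ) → n ≥ 1 →
    Σ (FreeDyck n → FreeDyck n) (λ f →
        ((p : FreeDyck n) → proj₁ (f (f p)) ≡ proj₁ p)
      × ((p : FreeDyck n) → flawBlocks (f p) % 2 ≢ flawBlocks p % 2))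
    × (sumTo n (term n) ≡ 0ℚ)
theorem4p1 (suc m) _ = (mirror , mirror-involutive , flawBlocks-mirror-parity) , alternating-sum≡0 m
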